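{- Let $B$ be a bipartite graph with vertex classes $\mathcal{R}$ and $W$ that has a matching saturating $\mathcal{R}$, and let $C\subseteq W$ be the maximal essential subset of $W$. If $p\in C$ and $s\in W\setminus C$, then $p$ is essential in $B$ if and only if $p$ is essential in $B-s$.
   Context: For a bipartite graph with vertex classes $X_1,X_2$, a subset $C\subseteq X_i$ is essential if there exists $U\subseteq X_{3-i}$ with $|U|=|C|$ and $C=N(U)$ ($N$ = neighborhood). When $B$ has a matching saturating $\mathcal{R}$, $W$ contains a unique inclusion-maximal essential subset. A vertex $p\in W$ is called essential (in a given bipartite graph with classes $\mathcal{R}$ and $W$) if the singleton $\{p\}$ is essential, i.e., some vertex $R\in\mathcal{R}$ has $p$ as its only neighbor. $B-s$ is the graph obtained by deleting the vertex $s$. -}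

module Defs where

open import Data.Nat using (ℕ; suc)
open import Data.Fin using (Fin; punchIn)
open import Data.Fin.Subset using (Subset; _∈_; _⊆_; ∣_∣; ⁅_⁆)
open import Data.Product using (Σ; _×_; ∃; ∃-syntax)
open import Relation.Binary.PropositionalEquality using (_≡_)
open import Function.Bundles using (_⇔_)
open import Function.Definitions using (Injective)

-- A finite bipartite graph with vertex classes ℛ = Fin m and W = Fin n,
-- given by its adjacency relation  Adj r w  (r ∈ ℛ, w ∈ W).
BipGraph : ℕ → ℕ → Set₁
BipGraph m n = Fin m → Fin n → Set

NbhdIs : ∀ {m n} → BipGraph m n → Subset m → Subset n → Set
NbhdIs {m} B U C = ∀ w → (w ∈ C) ⇔ (∃[ r ] (r ∈ U × B r w))

Essential : ∀ {m n} → BipGraph m n → Subset n → Set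
Essential {m} B C = Σ (Subset m) λ U → (∣ U ∣ ≡ ∣ C ∣) × NbhdIs B U C

MaxEssential : ∀ {m n} → BipGraph m n → Subset n → Set
MaxEssential {m} {n} B C =
  Essential B C × (∀ (D : Subset n) → Essential B D → C ⊆ D → D ⊆ C)

EssentialVertex : ∀ {m n} → BipGraph m n → Fin n → Set
EssentialVertex B p = Essential B ⁅ p ⁆

HasSaturatingMatching : ∀ {m n} → BipGraph m n → Set
HasSaturatingMatching {m} {n} B =
  Σ (Fin m → Fin n) λ f → Injective _≡_ _≡_ f × (∀ r → B r (f r))

-- B - s : delete the vertex s from W = Fin (suc n); the remaining vertices
-- are indexed by Fin n via punchIn s.
deleteW : ∀ {m n} → BipGraph m (suc n) → Fin (suc n) → BipGraph m n
deleteW B s r q = B r (punchIn s q)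

module Submission where

open import Defs
open import Data.Nat using (ℕ; suc)
open import Data.Fin using (Fin; punchIn; punchOut)
open import Data.Fin.Subset using (Subset; _∈_; _∉_; _∪_; ⁅_⁆; ∣_∣; inside; outside)
open import Data.Fin.Subset.Properties
  using (x∈⁅x⁆; x∈⁅y⁆⇒x≡y; ∣⁅x⁆∣≡1; _∈?_; x∈p∪q⁻; x∈p∪q⁺; p⊆p∪q; ∪-identityʳ)
open import Data.Fin.Properties using (punchIn-injective; punchIn-punchOut; _≟_)
open import Data.Vec using (_∷_; here; there)
open import Data.Product using (_×_; _,_; ∃-syntax)
open import Data.Sum using (_⊎_; inj₁; inj₂; [_,_])
open import Data.Empty using (⊥-elim)
open import Relation.Nullary using (yes; no; ¬_)
open import Relation.Binary.PropositionalEquality using (_≡_; refl; sym; trans; cong; subst)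
open import Function.Bundles using (_⇔_; mk⇔; Equivalence)
open Equivalence

-- If a vertex R with N(R) ⊆ {p, s} were adjacent to s ∉ C, then either s ∈ N(U) = C, or
-- adding R to the set U witnessing C would make C ∪ {s} essential, against maximality.
-- So deleting s does not change which R see only p.

private
  variable
    m n : ℕ

∣p∪⁅x⁆∣≡1+∣p∣ : ∀ (p : Subset n) {x} → x ∉ p → ∣ p ∪ ⁅ x ⁆ ∣ ≡ suc ∣ p ∣
∣p∪⁅x⁆∣≡1+∣p∣ (outside ∷ p) {Fin.zero}  x∉p rewrite ∪-identityʳ p = refl
∣p∪⁅x⁆∣≡1+∣p∣ (inside  ∷ p) {Fin.zero}  x∉p = ⊥-elim (x∉p here)
∣p∪⁅x⁆∣≡1+∣p∣ (outside ∷ p) {Fin.suc x} x∉p = ∣p∪⁅x⁆∣≡1+∣p∣ p (λ x∈p → x∉p (there x∈p))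
∣p∪⁅x⁆∣≡1+∣p∣ (inside  ∷ p) {Fin.suc x} x∉p = cong suc (∣p∪⁅x⁆∣≡1+∣p∣ p (λ x∈p → x∉p (there x∈p)))

∣⁅x⁆∣≡∣⁅y⁆∣ : (x : Fin m) (y : Fin n) → ∣ ⁅ x ⁆ ∣ ≡ ∣ ⁅ y ⁆ ∣
∣⁅x⁆∣≡∣⁅y⁆∣ x y = trans (∣⁅x⁆∣≡1 x) (sym (∣⁅x⁆∣≡1 y))

≡⊎punchIn : (s w : Fin (suc n)) → w ≡ s ⊎ ∃[ q ] punchIn s q ≡ w
≡⊎punchIn s w with s ≟ w
... | yes s≡w = inj₁ (sym s≡w)
... | no  s≢w = inj₂ (punchOut s≢w , punchIn-punchOut s≢w)

module _ {B : BipGraph m n} where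

  NbhdIs-∪⁅⁆ : ∀ {U C r s} → NbhdIs B U C → B r s → (∀ {w} → B r w → w ∈ C ∪ ⁅ s ⁆) →
               NbhdIs B (U ∪ ⁅ r ⁆) (C ∪ ⁅ s ⁆)
  NbhdIs-∪⁅⁆ {U} {C} {r} {s} N[U]≡C r~s N[r]⊆C∪s w = mk⇔ covered adjacent-in
    where
    covered : w ∈ C ∪ ⁅ s ⁆ → ∃[ r′ ] (r′ ∈ U ∪ ⁅ r ⁆ × B r′ w)
    covered w∈ with x∈p∪q⁻ C ⁅ s ⁆ w∈
    ... | inj₁ w∈C = let r′ , r′∈U , r′~w = to (N[U]≡C w) w∈C in r′ , p⊆p∪q ⁅ r ⁆ r′∈U , r′~w
    ... | inj₂ w∈s = r , x∈p∪q⁺ (inj₂ (x∈⁅x⁆ r)) , subst (B r) (sym (x∈⁅y⁆⇒x≡y s w∈s)) r~s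

    adjacent-in : ∃[ r′ ] (r′ ∈ U ∪ ⁅ r ⁆ × B r′ w) → w ∈ C ∪ ⁅ s ⁆
    adjacent-in (r′ , r′∈ , r′~w) with x∈p∪q⁻ U ⁅ r ⁆ r′∈
    ... | inj₁ r′∈U = p⊆p∪q ⁅ s ⁆ (from (N[U]≡C w) (r′ , r′∈U , r′~w))
    ... | inj₂ r′∈r = N[r]⊆C∪s (subst (λ z → B z w) (x∈⁅y⁆⇒x≡y r r′∈r) r′~w)

  MaxEssential⇒¬adjacent : ∀ {C r s} → MaxEssential B C → s ∉ C →
                           (∀ {w} → B r w → w ∈ C ∪ ⁅ s ⁆) → ¬ B r s
  MaxEssential⇒¬adjacent {C} {r} {s} ((U , ∣U∣≡∣C∣ , N[U]≡C) , maximal) s∉C N[r]⊆C∪s r~s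
    with r ∈? U
  ... | yes r∈U = s∉C (from (N[U]≡C s) (r , r∈U , r~s))
  ... | no  r∉U = s∉C (maximal (C ∪ ⁅ s ⁆) C∪s-essential (p⊆p∪q ⁅ s ⁆) (x∈p∪q⁺ (inj₂ (x∈⁅x⁆ s))))
    where
    C∪s-essential : Essential B (C ∪ ⁅ s ⁆)
    C∪s-essential = U ∪ ⁅ r ⁆
                  , trans (∣p∪⁅x⁆∣≡1+∣p∣ U r∉U)
                          (trans (cong suc ∣U∣≡∣C∣) (sym (∣p∪⁅x⁆∣≡1+∣p∣ C s∉C)))
                  , NbhdIs-∪⁅⁆ N[U]≡C r~s N[r]⊆C∪s

module _ {B : BipGraph m (suc n)} {s : Fin (suc n)} {U : Subset m} {p : Fin n} where

  NbhdIs-deleteW⁺ : NbhdIs B U ⁅ punchIn s p ⁆ → NbhdIs (deleteW B s) U ⁅ p ⁆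
  NbhdIs-deleteW⁺ N[U]≡p′ q = mk⇔
    (λ q∈p → to (N[U]≡p′ (punchIn s q)) (subst (λ z → punchIn s z ∈ ⁅ punchIn s p ⁆)
                                               (sym (x∈⁅y⁆⇒x≡y p q∈p)) (x∈⁅x⁆ _)))
    (λ r~q → subst (_∈ ⁅ p ⁆)
                   (sym (punchIn-injective s q p (x∈⁅y⁆⇒x≡y _ (from (N[U]≡p′ (punchIn s q)) r~q))))
                   (x∈⁅x⁆ p))

  NbhdIs-deleteW⇒adjacent : NbhdIs (deleteW B s) U ⁅ p ⁆ →
                            ∀ {r w} → r ∈ U → B r w → w ≡ s ⊎ w ≡ punchIn s p
  NbhdIs-deleteW⇒adjacent N[U]≡p {r} {w} r∈U r~w with ≡⊎punchIn s w
  ... | inj₁ w≡s = inj₁ w≡s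
  ... | inj₂ (q , refl) = inj₂ (cong (punchIn s) (x∈⁅y⁆⇒x≡y p (from (N[U]≡p q) (r , r∈U , r~w))))

  NbhdIs-deleteW⁻ : (∀ {r} → r ∈ U → ¬ B r s) →
                    NbhdIs (deleteW B s) U ⁅ p ⁆ → NbhdIs B U ⁅ punchIn s p ⁆
  NbhdIs-deleteW⁻ U≁s N[U]≡p w = mk⇔
    (λ w∈p′ → let r , r∈U , r~p = to (N[U]≡p p) (x∈⁅x⁆ p)
              in r , r∈U , subst (B r) (sym (x∈⁅y⁆⇒x≡y _ w∈p′)) r~p)
    (λ { (r , r∈U , r~w) → [ (λ w≡s → ⊥-elim (U≁s r∈U (subst (B r) w≡s r~w)))
                           , (λ w≡p′ → subst (_∈ ⁅ punchIn s p ⁆) (sym w≡p′) (x∈⁅x⁆ _)) ]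
                             (NbhdIs-deleteW⇒adjacent N[U]≡p r∈U r~w) })

lemma3p4 : ∀ {m n} (B : BipGraph m (suc n)) (C : Subset (suc n)) →
    HasSaturatingMatching B → MaxEssential B C →
    (p : Fin n) (s : Fin (suc n)) → punchIn s p ∈ C → s ∉ C →
    EssentialVertex B (punchIn s p) ⇔ EssentialVertex (deleteW B s) p
lemma3p4 B C _ C-max p s p′∈C s∉C = mk⇔
  (λ (U , ∣U∣≡1 , N[U]≡p′) → U , trans ∣U∣≡1 (∣⁅x⁆∣≡∣⁅y⁆∣ (punchIn s p) p) , NbhdIs-deleteW⁺ N[U]≡p′)
  (λ (U , ∣U∣≡1 , N[U]≡p) → U , trans ∣U∣≡1 (∣⁅x⁆∣≡∣⁅y⁆∣ p (punchIn s p))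
                            , NbhdIs-deleteW⁻ (U≁s N[U]≡p) N[U]≡p)
  where
  U≁s : ∀ {U} → NbhdIs (deleteW B s) U ⁅ p ⁆ → ∀ {r} → r ∈ U → ¬ B r s
  U≁s N[U]≡p r∈U = MaxEssential⇒¬adjacent C-max s∉C λ r~w →
    [ (λ w≡s → x∈p∪q⁺ (inj₂ (subst (_∈ ⁅ s ⁆) (sym w≡s) (x∈⁅x⁆ s))))
    , (λ w≡p′ → p⊆p∪q ⁅ s ⁆ (subst (_∈ C) (sym w≡p′) p′∈C)) ]
    (NbhdIs-deleteW⇒adjacent N[U]≡p r∈U r~w)
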